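{- Let $k\geq 4$ and $n\geq 4$ be integers, and let $G$ be a graph on $(k-1/2)n$ vertices whose edges are colored with $k$ colors, with color classes $G_1,\ldots,G_k$, such that no $G_i$ has a connected component with more than $n$ vertices. Then \[e(G)\leq \binom{v(G)}{2}-\frac{n^2}{32}.\]
   Context: Graphs are finite and simple; $v(G)$, $e(G)$ are the numbers of vertices and edges. The color class $G_i$ is the spanning subgraph of $G$ consisting of the edges of color $i$. -}

module Defs where

open import Data.Nat using (ℕ; zero; suc; _+_; _*_; _≤_; _<ᵇ_)
open import Data.Fin using (Fin; toℕ)
open import Data.Maybe using (Maybe; just; nothing; is-just)
open import Data.Bool using (Bool; true; false; _∧_)
open import Data.List using (List; length; map; allFin)
open import Data.Nat.ListAction using (sum)
open import Data.List.Relation.Unary.All using (All)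
open import Data.List.Relation.Unary.Unique.Propositional using (Unique)
open import Relation.Binary.PropositionalEquality using (_≡_)

-- An edge-coloured simple graph on vertex set Fin N with k colours:
-- col u v ≡ just i  means  uv is an edge of colour i;  nothing means non-adjacent.
record ColouredGraph (N k : ℕ) : Set where
  field
    col   : Fin N → Fin N → Maybe (Fin k)
    sym   : ∀ u v → col u v ≡ col v u
    irref : ∀ v → col v v ≡ nothing
open ColouredGraph public

Adj : ∀ {N k} → ColouredGraph N k → Fin k → Fin N → Fin N → Set
Adj G i u v = col G u v ≡ just i

data Reach {N k} (G : ColouredGraph N k) (i : Fin k) (u : Fin N) : Fin N → Set where
  here : Reach G i u u
  step : ∀ {v w} → Reach G i u v → Adj G i v w → Reach G i u w

-- every connected component of G_i has at most n vertices:
-- any list of distinct vertices lying in the component of v has length ≤ n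
ComponentsAtMost : ∀ {N k} → ColouredGraph N k → Fin k → ℕ → Set
ComponentsAtMost {N} G i n =
  ∀ (v : Fin N) (xs : List (Fin N)) → Unique xs → All (Reach G i v) xs → length xs ≤ n

edgeIndicator : ∀ {N k} → ColouredGraph N k → Fin N → Fin N → ℕ
edgeIndicator G u v with (toℕ u <ᵇ toℕ v) ∧ is-just (col G u v)
... | true  = 1
... | false = 0

e : ∀ {N k} → ColouredGraph N k → ℕ
e {N} G = sum (map (λ u → sum (map (λ v → edgeIndicator G u v) (allFin N))) (allFin N))

module Submission where

-- The proof counts
-- ordered pairs of vertices.
--   * Cut the vertex set between the components of G_0, listed by their least vertex,
--     at a point where the two sides X, Y satisfy |x - y| ≤ n (a discrete
--     intermediate value argument, each component having at most n vertices).  Then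
--     4xy ≥ N² - n², and no edge of colour 0 crosses the cut.
--   * A crossing edge of colour i ≥ 1 lies inside a component of G_i; a component with
--     a vertices in X and b in Y holds 2ab ≤ n(a + b)/2 crossing ordered pairs, so each
--     such colour yields at most nN/2 of them, and all colours (k - 1)nN/2.
--   * Every ordered pair is an edge, a diagonal pair or a non-edge, and crossing pairs
--     are never diagonal, so 2e(G) + N + (2xy - crossing edges) ≤ N², i.e.
--     2e(G) + N + 2xy ≤ N² + (k - 1)nN/2.
-- Linear arithmetic with 2N = (2k - 1)n and k ≥ 4 turns this into e(G) ≤ C(N,2) - n²/32.
-- The file develops finite sums and counting, decidable components (by saturating a
-- breadth-first search), the two counting bounds and the balanced cut, then the arithmetic.

open import Defs hiding (sym)
open import Data.Nat using (ℕ; zero; suc; _+_; _*_; _∸_; _≤_; _<_; z≤n; s≤s; _<ᵇ_; _≡ᵇ_; _≤?_)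
open import Data.Nat.Properties
open import Data.Nat.Combinatorics using (_C_; nC1≡n; nCk+nC[k+1]≡[n+1]C[k+1])
open import Data.Fin using (Fin; zero; suc; toℕ)
import Data.Fin as Fin
import Data.Fin.Properties as Fin
open import Data.Bool using (Bool; true; false; T; T?; not; _∧_; _∨_)
import Data.Bool.Properties as Bool
open import Data.List using ([]; _∷_; map; length; allFin; tabulate; filter)
import Data.Nat.ListAction as List
open import Data.List.Relation.Unary.All.Properties using (all-filter)
open import Data.List.Relation.Unary.Unique.Propositional.Properties using (allFin⁺; filter⁺)
open import Data.Product using (∃; _×_; _,_; proj₁; proj₂)
open import Data.Sum using (_⊎_; inj₁; inj₂)
open import Data.Empty using (⊥-elim)
open import Data.Maybe using (just; nothing; is-just)
import Data.Maybe.Properties as Maybe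
open import Data.List.Relation.Unary.All as All using (_∷_)
open import Function.Bundles using (Equivalence)
open import Relation.Binary using (tri<; tri≈; tri>)
open import Relation.Nullary.Decidable using (map′; ¬?; decidable-stable)
open import Function using (_∘_)
open import Relation.Nullary using (Dec; yes; no; ¬_; does)
open import Relation.Binary.PropositionalEquality
open import Data.Nat.Tactic.RingSolver using (solve-∀)
open import Algebra.Properties.Semiring.Sum +-*-semiring
  using (sum; sum-syntax; sum-cong-≗; sum-replicate-zero; ∑-distrib-+; ∑-comm;
         *-distribˡ-sum; *-distribʳ-sum)

∑-const : ∀ N c → ∑[ i < N ] c ≡ N * c
∑-const zero c = refl
∑-const (suc N) c = cong (c +_) (∑-const N c)

∑-mono : ∀ {N} {f g : Fin N → ℕ} → (∀ i → f i ≤ g i) → sum f ≤ sum g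
∑-mono {zero} f≤g = z≤n
∑-mono {suc N} f≤g = +-mono-≤ (f≤g zero) (∑-mono (f≤g ∘ suc))

∑-mono-< : ∀ {N} {f g : Fin N → ℕ} → (∀ i → f i ≤ g i) → ∀ j → f j < g j → sum f < sum g
∑-mono-< {suc N} f≤g zero fj<gj = +-mono-<-≤ fj<gj (∑-mono (f≤g ∘ suc))
∑-mono-< {suc N} f≤g (suc j) fj<gj = +-mono-≤-< (f≤g zero) (∑-mono-< (f≤g ∘ suc) j fj<gj)

term≤∑ : ∀ {N} (f : Fin N → ℕ) j → f j ≤ sum f
term≤∑ f zero = m≤m+n (f zero) _
term≤∑ f (suc j) = ≤-trans (term≤∑ (f ∘ suc) j) (m≤n+m _ (f zero))

∑-product : ∀ {M N} (f : Fin M → ℕ) (g : Fin N → ℕ) →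
            sum f * sum g ≡ ∑[ i < M ] ∑[ j < N ] (f i * g j)
∑-product f g = trans (*-distribʳ-sum (sum g) f) (sum-cong-≗ (λ i → *-distribˡ-sum (f i) g))

listSum-tabulate : ∀ {A : Set} {N} (f : A → ℕ) (g : Fin N → A) → List.sum (map f (tabulate g)) ≡ sum (f ∘ g)
listSum-tabulate {N = zero} f g = refl
listSum-tabulate {N = suc N} f g = cong (f (g zero) +_) (listSum-tabulate f (g ∘ suc))

⟦_⟧ : Bool → ℕ
⟦ true ⟧ = 1
⟦ false ⟧ = 0

⟦⟧≤1 : ∀ b → ⟦ b ⟧ ≤ 1
⟦⟧≤1 true = ≤-refl
⟦⟧≤1 false = z≤n

⟦⟧-mono : ∀ {a b} → (T a → T b) → ⟦ a ⟧ ≤ ⟦ b ⟧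
⟦⟧-mono {false} a⇒b = z≤n
⟦⟧-mono {true} {true} a⇒b = ≤-refl
⟦⟧-mono {true} {false} a⇒b = ⊥-elim (a⇒b _)

⟦⟧-mono-< : ∀ {a b} → (T a → T b) → b ≢ a → ⟦ a ⟧ < ⟦ b ⟧
⟦⟧-mono-< {false} {false} a⇒b b≢a = ⊥-elim (b≢a refl)
⟦⟧-mono-< {false} {true} a⇒b b≢a = ≤-refl
⟦⟧-mono-< {true} {true} a⇒b b≢a = ⊥-elim (b≢a refl)
⟦⟧-mono-< {true} {false} a⇒b b≢a = ⊥-elim (a⇒b _)

δ : ∀ {N} → Fin N → Fin N → ℕ
δ a b = ⟦ does (a Fin.≟ b) ⟧

δ-sym : ∀ {N} (a b : Fin N) → δ a b ≡ δ b a
δ-sym a b with a Fin.≟ b | b Fin.≟ a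
... | yes _ | yes _ = refl
... | no _ | no _ = refl
... | yes a≡b | no b≢a = ⊥-elim (b≢a (sym a≡b))
... | no a≢b | yes b≡a = ⊥-elim (a≢b (sym b≡a))

δ-refl : ∀ {N} (a : Fin N) → δ a a ≡ 1
δ-refl a with a Fin.≟ a
... | yes _ = refl
... | no a≢a = ⊥-elim (a≢a refl)

∑-pick : ∀ {N} (a : Fin N) (f : Fin N → ℕ) → ∑[ v < N ] (δ a v * f v) ≡ f a
∑-pick {suc N} zero f rewrite sum-replicate-zero N = trans (+-identityʳ _) (+-identityʳ _)
∑-pick {suc N} (suc a) f = ∑-pick a (f ∘ suc)

∑-δ-row : ∀ {M} (a : Fin M) → ∑[ c < M ] δ a c ≡ 1
∑-δ-row a = trans (sum-cong-≗ (λ c → sym (*-identityʳ (δ a c)))) (∑-pick a (λ _ → 1))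

∑-δ : ∀ {M} (a : Fin M) → ∑[ c < M ] δ c a ≡ 1
∑-δ a = trans (sum-cong-≗ (λ c → δ-sym c a)) (∑-δ-row a)

δ-via-points : ∀ {M} (a b : Fin M) → δ a b ≡ ∑[ c < M ] (δ c a * δ c b)
δ-via-points a b = trans (sym (∑-pick a (λ c → δ c b))) (sum-cong-≗ (λ c → cong (_* δ c b) (δ-sym a c)))

∑∑-distrib-+ : ∀ {M N} (f g : Fin M → Fin N → ℕ) →
               ∑[ i < M ] ∑[ j < N ] (f i j + g i j) ≡ ∑[ i < M ] ∑[ j < N ] f i j + ∑[ i < M ] ∑[ j < N ] g i j
∑∑-distrib-+ f g = trans (sum-cong-≗ (λ i → ∑-distrib-+ (f i) (g i))) (∑-distrib-+ (λ i → sum (f i)) (λ i → sum (g i)))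

count : ∀ {N} → (Fin N → Bool) → ℕ
count {N} p = ∑[ v < N ] ⟦ p v ⟧

count≤N : ∀ {N} (p : Fin N → Bool) → count p ≤ N
count≤N {N} p = ≤-trans (∑-mono (λ v → ⟦⟧≤1 (p v))) (≤-reflexive (trans (∑-const N 1) (*-identityʳ N)))

count-< : ∀ {N} {p q : Fin N → Bool} → (∀ v → T (p v) → T (q v)) →
          ¬ (∀ v → q v ≡ p v) → count p < count q
count-< {N} {p} {q} p⊆q q≢p with Fin.¬∀⟶∃¬ N _ (λ v → q v Bool.≟ p v) q≢p
... | v , qv≢pv = ∑-mono-< (λ w → ⟦⟧-mono (p⊆q w)) v (⟦⟧-mono-< (p⊆q v) qv≢pv)

count-complement : ∀ {N} (p : Fin N → Bool) → count p + count (not ∘ p) ≡ N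
count-complement {N} p = begin
  count p + count (not ∘ p)          ≡⟨ ∑-distrib-+ (λ v → ⟦ p v ⟧) (λ v → ⟦ not (p v) ⟧) ⟨
  ∑[ v < N ] (⟦ p v ⟧ + ⟦ not (p v) ⟧) ≡⟨ sum-cong-≗ (λ v → split (p v)) ⟩
  ∑[ v < N ] 1                       ≡⟨ trans (∑-const N 1) (*-identityʳ N) ⟩
  N                                  ∎
  where
  open ≡-Reasoning
  split : ∀ b → ⟦ b ⟧ + ⟦ not b ⟧ ≡ 1
  split true = refl
  split false = refl

length-members : ∀ {A : Set} {N} (p : A → Bool) (g : Fin N → A) →
                 length (filter (T? ∘ p) (tabulate g)) ≡ count (p ∘ g)
length-members {N = zero} p g = refl
length-members {N = suc N} p g with p (g zero)
... | true = cong suc (length-members p (g ∘ suc))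
... | false = length-members p (g ∘ suc)

any : ∀ {N} → (Fin N → Bool) → Bool
any {zero} p = false
any {suc N} p = p zero ∨ any (p ∘ suc)

any-sound : ∀ {N} (p : Fin N → Bool) → T (any p) → ∃ λ v → T (p v)
any-sound {suc N} p holds with Equivalence.to Bool.T-∨ holds
... | inj₁ p₀ = zero , p₀
... | inj₂ rest with any-sound (p ∘ suc) rest
...   | v , pv = suc v , pv

any-complete : ∀ {N} (p : Fin N → Bool) v → T (p v) → T (any p)
any-complete {suc N} p zero pv = Equivalence.from Bool.T-∨ (inj₁ pv)
any-complete {suc N} p (suc v) pv = Equivalence.from Bool.T-∨ (inj₂ (any-complete (p ∘ suc) v pv))

any-ext : ∀ {N} {p q : Fin N → Bool} → (∀ v → p v ≡ q v) → any p ≡ any q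
any-ext {zero} p≗q = refl
any-ext {suc N} p≗q = cong₂ _∨_ (p≗q zero) (any-ext (p≗q ∘ suc))

-- Iterating an extensional, inflationary operator F on predicates over Fin N reaches a
-- fixed point within N + 1 steps: until it is fixed each step marks a new point, and only
-- N points are available.
module Saturation {N} (F : (Fin N → Bool) → Fin N → Bool)
                  (F-ext : ∀ {p q} → (∀ v → p v ≡ q v) → ∀ v → F p v ≡ F q v)
                  (F-inflationary : ∀ p v → T (p v) → T (F p v)) where

  iterate : (Fin N → Bool) → ℕ → Fin N → Bool
  iterate p zero = p
  iterate p (suc t) = F (iterate p t)

  Fixed : (Fin N → Bool) → Set
  Fixed p = ∀ v → F p v ≡ p v

  progress : ∀ p t → Fixed (iterate p t) ⊎ t ≤ count (iterate p t)
  progress p zero = inj₂ z≤n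
  progress p (suc t) with progress p t
  ... | inj₁ fixed = inj₁ (F-ext fixed)
  ... | inj₂ t≤count with Fin.all? (λ v → F (iterate p t) v Bool.≟ iterate p t v)
  ...   | yes fixed = inj₁ (F-ext fixed)
  ...   | no unfixed = inj₂ (≤-trans (s≤s t≤count) (count-< (F-inflationary (iterate p t)) unfixed))

  saturate : (Fin N → Bool) → Fin N → Bool
  saturate p = iterate p (suc N)

  saturate-fixed : ∀ p → Fixed (saturate p)
  saturate-fixed p with progress p (suc N)
  ... | inj₁ fixed = fixed
  ... | inj₂ N<count = ⊥-elim (<-irrefl refl (≤-trans N<count (count≤N (saturate p))))

  iterate-inflationary : ∀ p t v → T (p v) → T (iterate p t v)
  iterate-inflationary p zero v pv = pv
  iterate-inflationary p (suc t) v pv = F-inflationary _ v (iterate-inflationary p t v pv)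

module _ {N k} (G : ColouredGraph N k) (i : Fin k) where

  reach-trans : ∀ {u v w} → Reach G i u v → Reach G i v w → Reach G i u w
  reach-trans p here = p
  reach-trans p (step q a) = step (reach-trans p q) a

  reach-sym : ∀ {u v} → Reach G i u v → Reach G i v u
  reach-sym here = here
  reach-sym (step {v} {w} p a) =
    reach-trans (step here (trans (ColouredGraph.sym G w v) a)) (reach-sym p)

-- Reachability in G_i is decidable: breadth-first search from u, i.e. saturation of {u}
-- under "add every G_i-neighbour of a marked vertex", marks exactly the vertices reachable
-- from u.  The least reachable vertex then names the component of u.
module Components {N k} (G : ColouredGraph N k) (i : Fin k) where

  adj? : Fin N → Fin N → Bool
  adj? v w = does (Maybe.≡-dec Fin._≟_ (col G v w) (just i))

  adj?-sound : ∀ {v w} → T (adj? v w) → Adj G i v w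
  adj?-sound {v} {w} holds with Maybe.≡-dec Fin._≟_ (col G v w) (just i)
  ... | yes a = a

  adj?-complete : ∀ {v w} → Adj G i v w → T (adj? v w)
  adj?-complete {v} {w} a with Maybe.≡-dec Fin._≟_ (col G v w) (just i)
  ... | yes _ = _
  ... | no ¬a = ¬a a

  grow : (Fin N → Bool) → Fin N → Bool
  grow p w = p w ∨ any (λ v → p v ∧ adj? v w)

  grow-ext : ∀ {p q} → (∀ v → p v ≡ q v) → ∀ w → grow p w ≡ grow q w
  grow-ext p≗q w = cong₂ _∨_ (p≗q w) (any-ext (λ v → cong (_∧ adj? v w) (p≗q v)))

  grow-inflationary : ∀ p w → T (p w) → T (grow p w)
  grow-inflationary p w pw = Equivalence.from Bool.T-∨ (inj₁ pw)

  open Saturation grow grow-ext grow-inflationary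

  start : Fin N → Fin N → Bool
  start u v = does (u Fin.≟ v)

  reach? : Fin N → Fin N → Bool
  reach? u = saturate (start u)

  search-sound : ∀ u t v → T (iterate (start u) t v) → Reach G i u v
  search-sound u zero v holds with u Fin.≟ v
  ... | yes refl = here
  search-sound u (suc t) w holds with Equivalence.to Bool.T-∨ holds
  ... | inj₁ old = search-sound u t w old
  ... | inj₂ new with any-sound _ new
  ...   | v , marked∧adj with Equivalence.to Bool.T-∧ marked∧adj
  ...     | marked , a = step (search-sound u t v marked) (adj?-sound a)

  -- ... and every reachable vertex is marked, since the saturated set is closed under grow
  search-complete : ∀ {u v} → Reach G i u v → T (reach? u v)
  search-complete {u} here = iterate-inflationary (start u) (suc N) u (self u)
    where
    self : ∀ u → T (start u u)
    self u with u Fin.≟ u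
    ... | yes _ = _
    ... | no u≢u = u≢u refl
  search-complete {u} (step {v} {w} p a) =
    subst T (saturate-fixed (start u) w)
      (Equivalence.from Bool.T-∨ (inj₂ (any-complete _ v
        (Equivalence.from Bool.T-∧ (search-complete p , adj?-complete a)))))

  reach-dec : ∀ u v → Dec (Reach G i u v)
  reach-dec u v = map′ (search-sound u (suc N) v) search-complete (T? (reach? u v))

  least : ∀ u → ∃ λ r → Reach G i u r × (∀ v → v Fin.< r → ¬ Reach G i u v)
  least u with Fin.¬∀⟶∃¬-smallest N (λ v → ¬ Reach G i u v) (λ v → ¬? (reach-dec u v))
                 (λ unreachable → unreachable u here)
  ... | r , ¬¬reach , smaller =
    r , decidable-stable (reach-dec u r) ¬¬reach ,
    λ v v<r → subst (λ x → ¬ Reach G i u x) (inject-fromℕ< v<r) (smaller (Fin.fromℕ< v<r))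
    where
    inject-fromℕ< : ∀ {v} (v<r : v Fin.< r) → Fin.inject (Fin.fromℕ< v<r) ≡ v
    inject-fromℕ< v<r = Fin.toℕ-injective (trans (Fin.toℕ-inject (Fin.fromℕ< v<r)) (Fin.toℕ-fromℕ< v<r))

  rep : Fin N → Fin N
  rep u = proj₁ (least u)

  rep-reach : ∀ u → Reach G i u (rep u)
  rep-reach u = proj₁ (proj₂ (least u))

  rep-least : ∀ u v → v Fin.< rep u → ¬ Reach G i u v
  rep-least u = proj₂ (proj₂ (least u))

  -- rep is constant exactly on components: two representatives of one component are
  -- reachable from each other's source, so neither is smaller than the other
  rep-cong : ∀ {u w} → Reach G i u w → rep u ≡ rep w
  rep-cong {u} {w} u~w with Fin.<-cmp (rep u) (rep w)
  ... | tri≈ _ same _ = same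
  ... | tri< lt _ _ = ⊥-elim (rep-least w (rep u) lt (reach-trans G i (reach-sym G i u~w) (rep-reach u)))
  ... | tri> _ _ gt = ⊥-elim (rep-least u (rep w) gt (reach-trans G i u~w (rep-reach w)))

  rep-inv : ∀ {u w} → rep u ≡ rep w → Reach G i u w
  rep-inv {u} {w} same =
    reach-trans G i (rep-reach u) (subst (λ r → Reach G i r w) (sym same) (reach-sym G i (rep-reach w)))

connected-count : ∀ {N k} (G : ColouredGraph N k) (i : Fin k) {n} → ComponentsAtMost G i n →
                  (p : Fin N → Bool) → (∀ {v w} → T (p v) → T (p w) → Reach G i v w) → count p ≤ n
connected-count {N} G i {n} small p connected
  with filter (T? ∘ p) (allFin N) | length-members p (λ v → v)
     | all-filter (T? ∘ p) (allFin N) | filter⁺ (T? ∘ p) (allFin⁺ N)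
... | [] | len | _ | _ = subst (_≤ n) len z≤n
... | v ∷ vs | len | pv ∷ pvs | unique =
  subst (_≤ n) len (small v (v ∷ vs) unique (All.map (connected pv) (pv ∷ pvs)))

module _ {N k} (G : ColouredGraph N k) (i : Fin k) {n} (small : ComponentsAtMost G i n) where
  open Components G i

  class-size : ∀ c → ∑[ w < N ] δ c (rep w) ≤ n
  class-size c = connected-count G i small (λ w → does (c Fin.≟ rep w)) connect
    where
    connect : ∀ {v w} → T (does (c Fin.≟ rep v)) → T (does (c Fin.≟ rep w)) → Reach G i v w
    connect {v} {w} cv cw with c Fin.≟ rep v | c Fin.≟ rep w
    ... | yes c≡v | yes c≡w = rep-inv (trans (sym c≡v) c≡w)

separated : Bool → Bool → ℕ
separated a b = ⟦ a ⟧ * ⟦ not b ⟧ + ⟦ not a ⟧ * ⟦ b ⟧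

separated-same : ∀ a → separated a a ≡ 0
separated-same true = refl
separated-same false = refl

-- 4ab ≤ (a + b)²: with b = a + d the difference is d²
am-gm-ordered : ∀ {a b} → a ≤ b → 4 * (a * b) ≤ (a + b) * (a + b)
am-gm-ordered {a} a≤b with m≤n⇒∃[o]m+o≡n a≤b
... | d , refl = ≤-trans (m≤m+n _ (d * d)) (≤-reflexive (square a d))
  where
  square : ∀ a d → 4 * (a * (a + d)) + d * d ≡ (a + (a + d)) * (a + (a + d))
  square = solve-∀

am-gm : ∀ a b → 4 * (a * b) ≤ (a + b) * (a + b)
am-gm a b with ≤-total a b
... | inj₁ a≤b = am-gm-ordered a≤b
... | inj₂ b≤a = subst₂ _≤_ (cong (4 *_) (*-comm b a)) (cong₂ _*_ (+-comm b a) (+-comm b a)) (am-gm-ordered b≤a)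

-- A class with a points on one side and b on the other contains 2ab ≤ (a + b)²/2 such
-- pairs, so if all classes have at most n points there are at most nN/2 of them.
module SeparatedPairs {N M} (r : Fin N → Fin M) (χ : Fin N → Bool) where

  left right : Fin M → ℕ
  left c = ∑[ u < N ] (⟦ χ u ⟧ * δ c (r u))
  right c = ∑[ u < N ] (⟦ not (χ u) ⟧ * δ c (r u))

  class-total : ∀ c → left c + right c ≡ ∑[ u < N ] δ c (r u)
  class-total c = trans (sym (∑-distrib-+ (λ u → ⟦ χ u ⟧ * δ c (r u)) (λ u → ⟦ not (χ u) ⟧ * δ c (r u))))
                        (sum-cong-≗ (λ u → sides (χ u) (δ c (r u))))
    where
    sides : ∀ b d → ⟦ b ⟧ * d + ⟦ not b ⟧ * d ≡ d
    sides true d = trans (+-identityʳ (d + 0)) (+-identityʳ d)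
    sides false d = +-identityʳ d

  -- counting the separated pairs within a class through the class c they share
  pairs-by-class : ∑[ u < N ] ∑[ w < N ] (separated (χ u) (χ w) * δ (r u) (r w))
                 ≡ ∑[ c < M ] (left c * right c + right c * left c)
  pairs-by-class = begin
    ∑[ u < N ] ∑[ w < N ] (separated (χ u) (χ w) * δ (r u) (r w))
      ≡⟨ sum-cong-≗ (λ u → sum-cong-≗ (λ w → trans (cong (separated (χ u) (χ w) *_) (δ-via-points (r u) (r w)))
                                                  (*-distribˡ-sum (separated (χ u) (χ w))
                                                                  (λ c → δ c (r u) * δ c (r w))))) ⟩
    ∑[ u < N ] ∑[ w < N ] ∑[ c < M ] term u w c
      ≡⟨ sum-cong-≗ (λ u → ∑-comm (term u)) ⟩
    ∑[ u < N ] ∑[ c < M ] ∑[ w < N ] term u w c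
      ≡⟨ ∑-comm (λ u c → ∑[ w < N ] term u w c) ⟩
    ∑[ c < M ] ∑[ u < N ] ∑[ w < N ] term u w c
      ≡⟨ sum-cong-≗ per-class ⟩
    ∑[ c < M ] (left c * right c + right c * left c) ∎
    where
    open ≡-Reasoning
    term : Fin N → Fin N → Fin M → ℕ
    term u w c = separated (χ u) (χ w) * (δ c (r u) * δ c (r w))

    regroup : ∀ a b a' b' p q → (a * b + a' * b') * (p * q) ≡ (a * p) * (b * q) + (a' * p) * (b' * q)
    regroup = solve-∀

    per-class : ∀ c → ∑[ u < N ] ∑[ w < N ] term u w c ≡ left c * right c + right c * left c
    per-class c = begin
      ∑[ u < N ] ∑[ w < N ] term u w c
        ≡⟨ sum-cong-≗ (λ u → sum-cong-≗ (λ w → regroup ⟦ χ u ⟧ ⟦ not (χ w) ⟧ ⟦ not (χ u) ⟧ ⟦ χ w ⟧ _ _)) ⟩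
      ∑[ u < N ] ∑[ w < N ] ((⟦ χ u ⟧ * δ c (r u)) * (⟦ not (χ w) ⟧ * δ c (r w))
                           + (⟦ not (χ u) ⟧ * δ c (r u)) * (⟦ χ w ⟧ * δ c (r w)))
        ≡⟨ ∑∑-distrib-+ (λ u w → (⟦ χ u ⟧ * δ c (r u)) * (⟦ not (χ w) ⟧ * δ c (r w)))
                        (λ u w → (⟦ not (χ u) ⟧ * δ c (r u)) * (⟦ χ w ⟧ * δ c (r w))) ⟩
      _ ≡⟨ sym (cong₂ _+_ (∑-product (λ u → ⟦ χ u ⟧ * δ c (r u)) (λ w → ⟦ not (χ w) ⟧ * δ c (r w)))
                          (∑-product (λ u → ⟦ not (χ u) ⟧ * δ c (r u)) (λ w → ⟦ χ w ⟧ * δ c (r w)))) ⟩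
      left c * right c + right c * left c ∎

  separated-within-classes : ∀ {n} → (∀ c → ∑[ u < N ] δ c (r u) ≤ n) →
    2 * ∑[ u < N ] ∑[ w < N ] (separated (χ u) (χ w) * δ (r u) (r w)) ≤ n * N
  separated-within-classes {n} class≤n = begin
    2 * ∑[ u < N ] ∑[ w < N ] (separated (χ u) (χ w) * δ (r u) (r w))
      ≡⟨ cong (2 *_) pairs-by-class ⟩
    2 * ∑[ c < M ] (left c * right c + right c * left c)
      ≡⟨ *-distribˡ-sum 2 (λ c → left c * right c + right c * left c) ⟩
    ∑[ c < M ] (2 * (left c * right c + right c * left c))
      ≤⟨ ∑-mono per-class ⟩
    ∑[ c < M ] (n * ∑[ u < N ] δ c (r u))
      ≡⟨ sym (*-distribˡ-sum n (λ c → ∑[ u < N ] δ c (r u))) ⟩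
    n * ∑[ c < M ] ∑[ u < N ] δ c (r u)
      ≡⟨ cong (n *_) (trans (∑-comm (λ c u → δ c (r u))) (sum-cong-≗ (λ u → ∑-δ (r u)))) ⟩
    n * ∑[ u < N ] 1
      ≡⟨ cong (n *_) (trans (∑-const N 1) (*-identityʳ N)) ⟩
    n * N ∎
    where
    open ≤-Reasoning
    double : ∀ a b → 2 * (a * b + b * a) ≡ 4 * (a * b)
    double = solve-∀
    per-class : ∀ c → 2 * (left c * right c + right c * left c) ≤ n * ∑[ u < N ] δ c (r u)
    per-class c = begin
      2 * (left c * right c + right c * left c) ≡⟨ double (left c) (right c) ⟩
      4 * (left c * right c)                    ≤⟨ am-gm (left c) (right c) ⟩
      (left c + right c) * (left c + right c)   ≤⟨ *-monoˡ-≤ _ (≤-trans (≤-reflexive (class-total c)) (class≤n c)) ⟩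
      n * (left c + right c)                    ≡⟨ cong (n *_) (class-total c) ⟩
      n * ∑[ u < N ] δ c (r u)                  ∎

window : ∀ N n (g : ℕ → ℕ) → g 0 ≡ 0 → (∀ t → g (suc t) ≤ g t + n) →
         ∀ T → N ≤ 2 * g T + n → ∃ λ t → N ≤ 2 * g t + n × 2 * g t ≤ N + n
window N n g g₀ increment zero reached = 0 , reached , subst (λ z → 2 * z ≤ N + n) (sym g₀) z≤n
window N n g g₀ increment (suc T) reached with N ≤? 2 * g T + n
... | yes earlier = window N n g g₀ increment T earlier
... | no ¬earlier = suc T , reached , (begin
  2 * g (suc T)     ≤⟨ *-monoʳ-≤ 2 (increment T) ⟩
  2 * (g T + n)     ≡⟨ double-step (g T) n ⟩
  2 * g T + n + n   ≤⟨ +-monoˡ-≤ n (<⇒≤ (≰⇒> ¬earlier)) ⟩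
  N + n             ∎)
  where
  open ≤-Reasoning
  double-step : ∀ a n → 2 * (a + n) ≡ 2 * a + n + n
  double-step = solve-∀

window-balanced : ∀ {x y N n} → x + y ≡ N → N ≤ 2 * x + n → 2 * x ≤ N + n → x ≤ y + n × y ≤ x + n
window-balanced {x} {y} {n = n} refl N≤2x+n 2x≤N+n =
  +-cancelˡ-≤ x _ _ (subst₂ _≤_ (twice x) (+-assoc x y n) 2x≤N+n) ,
  +-cancelˡ-≤ x _ _ (subst (x + y ≤_) (shift x n) N≤2x+n)
  where
  twice : ∀ x → 2 * x ≡ x + x
  twice = solve-∀
  shift : ∀ x n → 2 * x + n ≡ x + (x + n)
  shift = solve-∀

<ᵇ-step : ∀ a t → ⟦ a <ᵇ suc t ⟧ ≤ ⟦ a <ᵇ t ⟧ + ⟦ a ≡ᵇ t ⟧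
<ᵇ-step zero zero = ≤-refl
<ᵇ-step zero (suc t) = ≤-refl
<ᵇ-step (suc a) zero = z≤n
<ᵇ-step (suc a) (suc t) = <ᵇ-step a t

-- Cutting the vertex set between the components of G_i, listed by their least vertex,
-- gives a 2-colouring that is constant on the edges of G_i and whose sides differ in
-- size by at most n, since adding one component changes a side by at most n vertices.
module BalancedCut {N k} (G : ColouredGraph N k) (i : Fin k) {n} (small : ComponentsAtMost G i n) where
  open Components G i

  below : ℕ → Fin N → Bool
  below t u = toℕ (rep u) <ᵇ t

  size : ℕ → ℕ
  size t = count (below t)

  size-step : ∀ t → size (suc t) ≤ size t + n
  size-step t = begin
    size (suc t)                                      ≤⟨ ∑-mono (λ u → <ᵇ-step (toℕ (rep u)) t) ⟩
    ∑[ u < N ] (⟦ below t u ⟧ + ⟦ toℕ (rep u) ≡ᵇ t ⟧) ≡⟨ ∑-distrib-+ (λ u → ⟦ below t u ⟧) (λ u → ⟦ toℕ (rep u) ≡ᵇ t ⟧) ⟩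
    size t + count (λ u → toℕ (rep u) ≡ᵇ t)           ≤⟨ +-monoʳ-≤ (size t) (connected-count G i small _ same-rep) ⟩
    size t + n                                        ∎
    where
    open ≤-Reasoning
    same-rep : ∀ {v w} → T (toℕ (rep v) ≡ᵇ t) → T (toℕ (rep w) ≡ᵇ t) → Reach G i v w
    same-rep {v} {w} vt wt = rep-inv (Fin.toℕ-injective (trans (≡ᵇ⇒≡ _ t vt) (sym (≡ᵇ⇒≡ _ t wt))))

  all-below : size N ≡ N
  all-below = trans (sum-cong-≗ (λ u → true-is-1 (<⇒<ᵇ (Fin.toℕ<n (rep u))))) (trans (∑-const N 1) (*-identityʳ N))
    where
    true-is-1 : ∀ {b} → T b → ⟦ b ⟧ ≡ 1
    true-is-1 {true} _ = refl

  balanced-cut : ∃ λ (χ : Fin N → Bool) → (∀ {u w} → Adj G i u w → χ u ≡ χ w)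
                   × count χ ≤ count (not ∘ χ) + n × count (not ∘ χ) ≤ count χ + n
  balanced-cut with window N n size (sum-replicate-zero N) size-step N
                     (subst (λ s → N ≤ 2 * s + n) (sym all-below) (≤-trans (m≤m+n N (N + 0)) (m≤m+n _ n)))
  ... | t , N≤2x+n , 2x≤N+n =
    below t , (λ a → cong (λ r → toℕ r <ᵇ t) (rep-cong (step here a))) ,
    window-balanced (count-complement (below t)) N≤2x+n 2x≤N+n

isEdge : ∀ {N k} → ColouredGraph N k → Fin N → Fin N → Bool
isEdge G u w = is-just (col G u w)

both-orders : ∀ a b c → (a ≡ b → c ≡ false) → ⟦ (a <ᵇ b) ∧ c ⟧ + ⟦ (b <ᵇ a) ∧ c ⟧ ≡ ⟦ c ⟧
both-orders zero zero c diagonal rewrite diagonal refl = refl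
both-orders zero (suc b) c diagonal = +-identityʳ ⟦ c ⟧
both-orders (suc a) zero c diagonal = refl
both-orders (suc a) (suc b) c diagonal = both-orders a b c (diagonal ∘ cong suc)

edges-ordered : ∀ {N k} (G : ColouredGraph N k) → e G + e G ≡ ∑[ u < N ] ∑[ w < N ] ⟦ isEdge G u w ⟧
edges-ordered {N} G = begin
  e G + e G                                     ≡⟨ cong₂ _+_ e-as-sum (trans e-as-sum (∑-comm ordered)) ⟩
  ∑[ u < N ] ∑[ w < N ] ordered u w + ∑[ u < N ] ∑[ w < N ] ordered w u
                                                ≡⟨ sym (∑∑-distrib-+ ordered (λ u w → ordered w u)) ⟩
  ∑[ u < N ] ∑[ w < N ] (ordered u w + ordered w u) ≡⟨ sum-cong-≗ (λ u → sum-cong-≗ (λ w → unordered u w)) ⟩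
  ∑[ u < N ] ∑[ w < N ] ⟦ isEdge G u w ⟧        ∎
  where
  open ≡-Reasoning
  ordered : Fin N → Fin N → ℕ
  ordered u w = ⟦ (toℕ u <ᵇ toℕ w) ∧ isEdge G u w ⟧

  indicator : ∀ u w → edgeIndicator G u w ≡ ordered u w
  indicator u w with (toℕ u <ᵇ toℕ w) ∧ isEdge G u w
  ... | true = refl
  ... | false = refl

  e-as-sum : e G ≡ ∑[ u < N ] ∑[ w < N ] ordered u w
  e-as-sum = trans (listSum-tabulate (λ u → List.sum (map (edgeIndicator G u) (allFin N))) (λ u → u))
                   (sum-cong-≗ (λ u → trans (listSum-tabulate (edgeIndicator G u) (λ w → w))
                                            (sum-cong-≗ (indicator u))))

  unordered : ∀ u w → ordered u w + ordered w u ≡ ⟦ isEdge G u w ⟧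
  unordered u w rewrite cong is-just (ColouredGraph.sym G w u) =
    both-orders (toℕ u) (toℕ w) (isEdge G u w) loopless
    where
    loopless : toℕ u ≡ toℕ w → isEdge G u w ≡ false
    loopless same with Fin.toℕ-injective same
    ... | refl = cong is-just (irref G u)

separatedEdges : ∀ {N k} → ColouredGraph N k → (Fin N → Bool) → ℕ
separatedEdges {N} G χ = ∑[ u < N ] ∑[ w < N ] (separated (χ u) (χ w) * ⟦ isEdge G u w ⟧)

-- An ordered pair is an edge, a diagonal pair or neither; a diagonal pair is no edge and
-- is not separated, and a separated non-edge takes the place of the missing 1.
pair-bound : ∀ edge diagonal a b → (T diagonal → edge ≡ false × a ≡ b) →
             ⟦ edge ⟧ + ⟦ diagonal ⟧ + separated a b ≤ 1 + separated a b * ⟦ edge ⟧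
pair-bound edge true a b loopless with loopless _
pair-bound .false true true .true _ | refl , refl = ≤-refl
pair-bound .false true false .false _ | refl , refl = ≤-refl
pair-bound true false a b _ = s≤s (≤-reflexive (sym (*-identityʳ (separated a b))))
pair-bound false false true true _ = z≤n
pair-bound false false true false _ = ≤-refl
pair-bound false false false true _ = ≤-refl
pair-bound false false false false _ = z≤n

pairs-count : ∀ {N k} (G : ColouredGraph N k) (χ : Fin N → Bool) →
  e G + e G + N + (count χ * count (not ∘ χ) + count (not ∘ χ) * count χ) ≤ N * N + separatedEdges G χ
pairs-count {N} G χ = begin
  e G + e G + N + (count χ * count (not ∘ χ) + count (not ∘ χ) * count χ)
    ≡⟨ cong₂ _+_ (cong₂ _+_ (edges-ordered G) diagonal) (sym sides) ⟩
  ∑∑ edge + ∑∑ δ + ∑∑ sep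
    ≡⟨ trans (cong (_+ ∑∑ sep) (sym (∑∑-distrib-+ edge δ))) (sym (∑∑-distrib-+ (λ u w → edge u w + δ u w) sep)) ⟩
  ∑∑ (λ u w → edge u w + δ u w + sep u w)
    ≤⟨ ∑-mono (λ u → ∑-mono (λ w → pair-bound (isEdge G u w) (does (u Fin.≟ w)) (χ u) (χ w) (loopless u w))) ⟩
  ∑∑ (λ u w → 1 + sep u w * edge u w)
    ≡⟨ ∑∑-distrib-+ (λ _ _ → 1) (λ u w → sep u w * edge u w) ⟩
  ∑∑ (λ _ _ → 1) + separatedEdges G χ
    ≡⟨ cong (_+ separatedEdges G χ) (trans (∑-const N (∑[ w < N ] 1)) (cong (N *_) (trans (∑-const N 1) (*-identityʳ N)))) ⟩
  N * N + separatedEdges G χ ∎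
  where
  open ≤-Reasoning
  ∑∑ : (Fin N → Fin N → ℕ) → ℕ
  ∑∑ f = ∑[ u < N ] ∑[ w < N ] f u w
  edge sep : Fin N → Fin N → ℕ
  edge u w = ⟦ isEdge G u w ⟧
  sep u w = separated (χ u) (χ w)

  diagonal : N ≡ ∑∑ δ
  diagonal = sym (trans (sum-cong-≗ (∑-δ-row {N})) (trans (∑-const N 1) (*-identityʳ N)))

  sides : ∑∑ sep ≡ count χ * count (not ∘ χ) + count (not ∘ χ) * count χ
  sides = trans (∑∑-distrib-+ (λ u w → ⟦ χ u ⟧ * ⟦ not (χ w) ⟧) (λ u w → ⟦ not (χ u) ⟧ * ⟦ χ w ⟧))
                (sym (cong₂ _+_ (∑-product (λ u → ⟦ χ u ⟧) (λ w → ⟦ not (χ w) ⟧))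
                                (∑-product (λ u → ⟦ not (χ u) ⟧) (λ w → ⟦ χ w ⟧))))

  loopless : ∀ u w → T (does (u Fin.≟ w)) → isEdge G u w ≡ false × χ u ≡ χ w
  loopless u w u≟w with u Fin.≟ w
  ... | yes refl = cong is-just (irref G u) , refl

-- If χ is constant on the edges of colour 0, every edge separated by χ has a colour suc j
-- and joins two vertices of one component of G_(suc j); by separated-within-classes each
-- of these k' colour classes contributes at most nN/2 such ordered pairs.
separated-edges-bound : ∀ {N k'} (G : ColouredGraph N (suc k')) {n} → (∀ i → ComponentsAtMost G i n) →
  (χ : Fin N → Bool) → (∀ {u w} → Adj G zero u w → χ u ≡ χ w) → 2 * separatedEdges G χ ≤ k' * (n * N)
separated-edges-bound {N} {k'} G {n} small χ χ-respects = begin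
  2 * separatedEdges G χ
    ≤⟨ *-monoʳ-≤ 2 (∑-mono (λ u → ∑-mono (λ w → edge-in-some-class u w))) ⟩
  2 * ∑[ u < N ] ∑[ w < N ] ∑[ j < k' ] within j u w
    ≡⟨ cong (2 *_) (trans (sum-cong-≗ (λ u → ∑-comm (λ w j → within j u w)))
                          (∑-comm (λ u j → ∑[ w < N ] within j u w))) ⟩
  2 * ∑[ j < k' ] ∑[ u < N ] ∑[ w < N ] within j u w
    ≡⟨ *-distribˡ-sum 2 (λ j → ∑[ u < N ] ∑[ w < N ] within j u w) ⟩
  ∑[ j < k' ] (2 * ∑[ u < N ] ∑[ w < N ] within j u w)
    ≤⟨ ∑-mono (λ j → SeparatedPairs.separated-within-classes (rep j) χ
                        (class-size G (suc j) (small (suc j)))) ⟩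
  ∑[ j < k' ] (n * N)
    ≡⟨ ∑-const k' (n * N) ⟩
  k' * (n * N) ∎
  where
  open ≤-Reasoning
  rep : Fin k' → Fin N → Fin N
  rep j = Components.rep G (suc j)

  within : Fin k' → Fin N → Fin N → ℕ
  within j u w = separated (χ u) (χ w) * δ (rep j u) (rep j w)

  edge-in-some-class : ∀ u w → separated (χ u) (χ w) * ⟦ isEdge G u w ⟧ ≤ ∑[ j < k' ] within j u w
  edge-in-some-class u w with col G u w in colour
  ... | nothing = subst (_≤ ∑[ j < k' ] within j u w) (sym (*-zeroʳ (separated (χ u) (χ w)))) z≤n
  ... | just zero rewrite χ-respects colour | separated-same (χ w) = z≤n
  ... | just (suc j) = ≤-trans (≤-reflexive (cong (separated (χ u) (χ w) *_) (sym same-class)))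
                               (term≤∑ (λ j → within j u w) j)
    where
    same-class : δ (rep j u) (rep j w) ≡ 1
    same-class rewrite Components.rep-cong G (suc j) (step here colour) = δ-refl (rep j w)

choose-2 : ∀ N → N + 2 * (N C 2) ≡ N * N
choose-2 zero = refl
choose-2 (suc N) = begin
  suc N + 2 * (suc N C 2)        ≡⟨ cong (λ c → suc N + 2 * c) (sym (nCk+nC[k+1]≡[n+1]C[k+1] N 1)) ⟩
  suc N + 2 * (N C 1 + N C 2)    ≡⟨ cong (λ c → suc N + 2 * (c + N C 2)) (nC1≡n N) ⟩
  suc N + 2 * (N + N C 2)        ≡⟨ regroup N (N C 2) ⟩
  suc N + N + (N + 2 * (N C 2))  ≡⟨ cong (suc N + N +_) (choose-2 N) ⟩
  suc N + N + N * N              ≡⟨ square N ⟩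
  suc N * suc N                  ∎
  where
  open ≡-Reasoning
  regroup : ∀ N c → suc N + 2 * (N + c) ≡ suc N + N + (N + 2 * c)
  regroup = solve-∀
  square : ∀ N → suc N + N + N * N ≡ suc N * suc N
  square = solve-∀

-- if x ≤ y ≤ x + n, say y = x + d, then (x + y)² = 4xy + d² ≤ 4xy + n²
balanced-product-ordered : ∀ {x y n} → x ≤ y → y ≤ x + n → (x + y) * (x + y) ≤ 4 * (x * y) + n * n
balanced-product-ordered {x} {n = n} x≤y y≤x+n with m≤n⇒∃[o]m+o≡n x≤y
... | d , refl = begin
  (x + (x + d)) * (x + (x + d)) ≡⟨ square x d ⟩
  4 * (x * (x + d)) + d * d     ≤⟨ +-monoʳ-≤ _ (*-mono-≤ d≤n d≤n) ⟩
  4 * (x * (x + d)) + n * n     ∎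
  where
  open ≤-Reasoning
  d≤n : d ≤ n
  d≤n = +-cancelˡ-≤ x d n y≤x+n
  square : ∀ x d → (x + (x + d)) * (x + (x + d)) ≡ 4 * (x * (x + d)) + d * d
  square = solve-∀

balanced-product : ∀ {x y n} → x ≤ y + n → y ≤ x + n → (x + y) * (x + y) ≤ 4 * (x * y) + n * n
balanced-product {x} {y} {n} x≤y+n y≤x+n with ≤-total x y
... | inj₁ x≤y = balanced-product-ordered x≤y y≤x+n
... | inj₂ y≤x = subst₂ _≤_ (cong₂ _*_ (+-comm y x) (+-comm y x)) (cong (λ p → 4 * p + n * n) (*-comm y x))
                        (balanced-product-ordered y≤x x≤y+n)

-- When 2N = (2k' + 1)n with k' ≥ 3, a cut with sides differing by at most n has more
-- separated pairs than k' colour classes can cover (at most nN/2 each), with n²/32 to spare.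
cut-surplus : ∀ {x y N n k'} → x + y ≡ N → x ≤ y + n → y ≤ x + n → 2 * N ≡ (2 * k' + 1) * n → 3 ≤ k' →
              n * n + 8 * k' * (n * N) ≤ 32 * (x * y)
cut-surplus {x} {y} {N} {n} {k'} refl x≤y+n y≤x+n 2N≡ 3≤k' = +-cancelʳ-≤ (8 * (n * n)) _ _ (begin
  n * n + 8 * k' * (n * N) + 8 * (n * n) ≡⟨ regroup n k' N ⟩
  8 * k' * (n * N) + 9 * (n * n)          ≤⟨ +-monoʳ-≤ (8 * k' * (n * N)) small-square ⟩
  8 * k' * (n * N) + 4 * (n * N)          ≡⟨ expand n k' N ⟩
  4 * N * ((2 * k' + 1) * n)              ≡⟨ cong (4 * N *_) (sym 2N≡) ⟩
  4 * N * (2 * N)                         ≡⟨ square N ⟩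
  8 * (N * N)                             ≤⟨ *-monoʳ-≤ 8 (balanced-product x≤y+n y≤x+n) ⟩
  8 * (4 * (x * y) + n * n)               ≡⟨ distribute x y n ⟩
  32 * (x * y) + 8 * (n * n)              ∎)
  where
  open ≤-Reasoning
  regroup : ∀ n k' N → n * n + 8 * k' * (n * N) + 8 * (n * n) ≡ 8 * k' * (n * N) + 9 * (n * n)
  regroup = solve-∀
  expand : ∀ n k' N → 8 * k' * (n * N) + 4 * (n * N) ≡ 4 * N * ((2 * k' + 1) * n)
  expand = solve-∀
  square : ∀ N → 4 * N * (2 * N) ≡ 8 * (N * N)
  square = solve-∀
  distribute : ∀ x y n → 8 * (4 * (x * y) + n * n) ≡ 32 * (x * y) + 8 * (n * n)
  distribute = solve-∀

  -- 9n² ≤ 4nN, because N ≥ 7n/2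
  small-square : 9 * (n * n) ≤ 4 * (n * N)
  small-square = *-cancelˡ-≤ 2 (begin
    2 * (9 * (n * n))           ≡⟨ *-assoc 2 9 (n * n) ⟨
    18 * (n * n)                ≤⟨ *-monoˡ-≤ (n * n) (m≤m+n 18 10) ⟩
    28 * (n * n)                ≡⟨ seven n ⟩
    4 * n * (7 * n)             ≤⟨ *-monoʳ-≤ (4 * n) (*-monoˡ-≤ n (+-monoˡ-≤ 1 (*-monoʳ-≤ 2 3≤k'))) ⟩
    4 * n * ((2 * k' + 1) * n)  ≡⟨ cong (4 * n *_) (sym 2N≡) ⟩
    4 * n * (2 * N)             ≡⟨ halve n N ⟩
    2 * (4 * (n * N))           ∎)
    where
    seven : ∀ n → 28 * (n * n) ≡ 4 * n * (7 * n)
    seven = solve-∀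
    halve : ∀ n N → 4 * n * (2 * N) ≡ 2 * (4 * (n * N))
    halve = solve-∀

-- Sixteen times the pair count, with the bound on separated edges and the surplus of the
-- cut, gives 32e + n² ≤ 32B, where N + 2B = N², i.e. B = C(N,2).
final-bound : ∀ {e B N n k' x y P} → e + e + N + (x * y + y * x) ≤ N * N + P → 2 * P ≤ k' * (n * N) →
              n * n + 8 * k' * (n * N) ≤ 32 * (x * y) → N + 2 * B ≡ N * N → 32 * e + n * n ≤ 32 * B
final-bound {e} {B} {N} {n} {k'} {x} {y} {P} pairs separated-edges surplus choose =
  +-cancelʳ-≤ (8 * k' * (n * N)) _ _ (+-cancelˡ-≤ (16 * N) _ _ (begin
    16 * N + (32 * e + n * n + 8 * k' * (n * N))   ≡⟨ cong (16 * N +_) (+-assoc (32 * e) _ _) ⟩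
    16 * N + (32 * e + (n * n + 8 * k' * (n * N))) ≤⟨ +-monoʳ-≤ (16 * N) (+-monoʳ-≤ (32 * e) surplus) ⟩
    16 * N + (32 * e + 32 * (x * y))               ≡⟨ scale e N x y ⟩
    16 * (e + e + N + (x * y + y * x))             ≤⟨ *-monoʳ-≤ 16 pairs ⟩
    16 * (N * N + P)                               ≡⟨ cong (λ s → 16 * (s + P)) (sym choose) ⟩
    16 * (N + 2 * B + P)                           ≡⟨ expand N B P ⟩
    16 * N + (32 * B + 8 * (2 * P))                ≤⟨ +-monoʳ-≤ (16 * N) (+-monoʳ-≤ (32 * B) (*-monoʳ-≤ 8 separated-edges)) ⟩
    16 * N + (32 * B + 8 * (k' * (n * N)))         ≡⟨ cong (λ s → 16 * N + (32 * B + s)) (sym (*-assoc 8 k' (n * N))) ⟩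
    16 * N + (32 * B + 8 * k' * (n * N))           ∎))
  where
  open ≤-Reasoning
  scale : ∀ e N x y → 16 * N + (32 * e + 32 * (x * y)) ≡ 16 * (e + e + N + (x * y + y * x))
  scale = solve-∀
  expand : ∀ N B P → 16 * (N + 2 * B + P) ≡ 16 * N + (32 * B + 8 * (2 * P))
  expand = solve-∀

-- the hypothesis 2N = (2k - 1)n for k = k' + 1
odd : ∀ k' → 2 * suc k' ∸ 1 ≡ 2 * k' + 1
odd k' = cong (_∸ 1) (double-suc k')
  where
  double-suc : ∀ k' → 2 * suc k' ≡ suc (2 * k' + 1)
  double-suc = solve-∀

lemma15 : ∀ (k n N : ℕ) → 4 ≤ k → 4 ≤ n → 2 * N ≡ (2 * k ∸ 1) * n →
            (G : ColouredGraph N k) →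
            (∀ (i : Fin k) → ComponentsAtMost G i n) →
            32 * e G + n * n ≤ 32 * (N C 2)
lemma15 zero n N () _ _ _ _
lemma15 (suc k') n N (s≤s 3≤k') _ 2N≡ G small with BalancedCut.balanced-cut G zero (small zero)
... | χ , χ-respects , x≤y+n , y≤x+n =
  final-bound {e G} {N C 2} {N} {n} {k'} {count χ} {count (not ∘ χ)} {separatedEdges G χ}
    (pairs-count G χ) (separated-edges-bound G small χ χ-respects)
    (cut-surplus (count-complement χ) x≤y+n y≤x+n (trans 2N≡ (cong (_* n) (odd k'))) 3≤k')
    (choose-2 N)
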